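{- Fix $k\ge2$. For all $n\ge0$, $0\le m\le n$ and $0\le a\le k-1$, $D^{k,a}_{n,m}=M^{k-1}_{n,m}(\vec\alpha,\vec\beta)$, where $\vec\alpha=(\alpha_0,\dots,\alpha_{k-2})$ and $\vec\beta=(\beta_0,\dots,\beta_{k-2})$ are given by $\alpha_i=\binom{k}{i+1}-\binom{k-a-1}{i+1}$ and $\beta_i=\binom{k}{i+1}$ for $0\le i\le k-2$.
   Context: For $k\ge2$ and $a\ge0$, $D^{k,a}_{n,m}$ is the number of integer lattice paths from $(0,0)$ to $(kn,km)$ using steps $U=(1,1)$ and $(1,1-k)$ that stay weakly above the line $y=-a$. An order-$\ell$ Motzkin path of length $n$ and height $m$ is an integer lattice path from $(0,0)$ to $(n,m)$ using steps $U=(1,1)$ and $D_i=(1,-i)$ for $0\le i\le \ell$, never going below $y=0$. For $\ell$-tuples of non-negative integers $\vec\alpha=(\alpha_0,\dots,\alpha_{\ell-1}),\vec\beta=(\beta_0,\dots,\beta_{\ell-1})$, an $(\vec\alpha,\vec\beta)$-colored Motzkin path is such a path in which, for each $0\le i\le \ell-1$, each $D_i$ step whose right endpoint is at height $0$ is labeled by one of $\alpha_i$ colors and each $D_i$ step whose right endpoint is at height $>0$ is labeled by one of $\beta_i$ colors; $U$ and $D_\ell$ steps are unlabeled. $M^\ell_{n,m}(\vec\alpha,\vec\beta)$ is the number of such colored paths of length $n$ and height $m$. Binomial coefficients $\binom{p}{q}$ with $q>p\ge 0$ are $0$. -}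

module Defs where

open import Data.Bool using (Bool; true; false; _∧_)
open import Data.Nat using (ℕ; zero; suc; _<ᵇ_)
open import Data.Fin using (Fin; toℕ)
open import Data.Integer using (ℤ; +_; _+_; _-_; -_; _≤ᵇ_; _≟_)
open import Relation.Nullary.Decidable using (⌊_⌋)
open import Data.List using (List; []; _∷_; map; concatMap; length; filterᵇ; allFin)

words : {A : Set} → List A → ℕ → List (List A)
words xs zero    = [] ∷ []
words xs (suc n) = concatMap (λ x → map (x ∷_) (words xs n)) xs

-- D^{k,a}_{n,m}: lattice paths from (0,0) to (kn,km) with steps
-- U = (1,1) and (1,1-k), staying weakly above y = -a.

data DStep : Set where
  U  : DStep
  Dk : DStep

dAlphabet : List DStep
dAlphabet = U ∷ Dk ∷ []

dRise : ℕ → DStep → ℤ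
dRise k U  = + 1
dRise k Dk = + 1 - + k

isDPath : (k a : ℕ) → ℤ → ℤ → List DStep → Bool
isDPath k a h t []       = ⌊ h ≟ t ⌋
isDPath k a h t (s ∷ ss) =
  (- (+ a) ≤ᵇ (h + dRise k s)) ∧ isDPath k a (h + dRise k s) t ss

D : (k a n m : ℕ) → ℕ
D k a n m =
  length (filterᵇ (isDPath k a (+ 0) (+ (k Data.Nat.* m)))
                  (words dAlphabet (k Data.Nat.* n)))

-- Order-ℓ Motzkin paths with (α,β)-colourings.
-- Steps: U = (1,1), D_ℓ = (1,-ℓ) (uncoloured), and coloured steps
-- D_i = (1,-i) for i < ℓ carrying a colour c : ℕ.

data MStep (ℓ : ℕ) : Set where
  MU   : MStep ℓ
  MDl  : MStep ℓ
  MDc  : Fin ℓ → ℕ → MStep ℓ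

-- finite alphabet: colour c of a D_i step ranges over c < α_i + β_i,
-- which contains every admissible colour (validity below cuts it down).
mAlphabet : (ℓ : ℕ) → (Fin ℓ → ℕ) → (Fin ℓ → ℕ) → List (MStep ℓ)
mAlphabet ℓ α β =
  MU ∷ MDl ∷ concatMap (λ i → map (MDc i) (Data.List.upTo (α i Data.Nat.+ β i))) (allFin ℓ)

mRise : (ℓ : ℕ) → MStep ℓ → ℤ
mRise ℓ MU        = + 1
mRise ℓ MDl       = - (+ ℓ)
mRise ℓ (MDc i c) = - (+ toℕ i)

colourOK : (ℓ : ℕ) → (Fin ℓ → ℕ) → (Fin ℓ → ℕ) → ℤ → MStep ℓ → Bool
colourOK ℓ α β h' MU        = true
colourOK ℓ α β h' MDl       = true
colourOK ℓ α β h' (MDc i c) with ⌊ h' ≟ + 0 ⌋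
... | true  = c <ᵇ α i
... | false = c <ᵇ β i

isMPath : (ℓ : ℕ) → (Fin ℓ → ℕ) → (Fin ℓ → ℕ) → ℤ → ℤ → List (MStep ℓ) → Bool
isMPath ℓ α β h t []       = ⌊ h ≟ t ⌋
isMPath ℓ α β h t (s ∷ ss) =
  (+ 0 ≤ᵇ (h + mRise ℓ s)) ∧ colourOK ℓ α β (h + mRise ℓ s) s
    ∧ isMPath ℓ α β (h + mRise ℓ s) t ss

M : (ℓ : ℕ) → (Fin ℓ → ℕ) → (Fin ℓ → ℕ) → (n m : ℕ) → ℕ
M ℓ α β n m = length (filterᵇ (isMPath ℓ α β (+ 0) (+ m)) (words (mAlphabet ℓ α β) n))

module Submission where

-- Measure heights from the floor y = -a.  Every step rises by 1 or by 1 - k, so after each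
-- block of k steps a D-path is at a height k H + a.  A block containing e down-steps goes
-- from k H + a to k (H + 1 - e) + a, so it acts as one Motzkin step: U for e = 0, D_(e-1)
-- for 1 ≤ e ≤ k-1 and D_(k-1) for e = k.  A block has at most k steps, so it can only dip
-- below the floor right after its last down-step; hence of the C(k,e) arrangements exactly
-- C(k-a-1,e) are inadmissible when the block ends at height a (H = e - 1), and none are
-- otherwise.  These are the colour counts α_(e-1) and β_(e-1), so both sides satisfy the
-- same recurrence in n.

open import Defs

open import Algebra.Bundles using (AbelianGroup)
open import Data.Bool using (Bool; true; false; T; _∧_; if_then_else_)
open import Data.Bool.Properties using (T-≡; ¬-not)
open import Data.Empty using (⊥-elim)
open import Data.Fin as Fin using (Fin; toℕ)
open import Data.List
  using (List; []; _∷_; _++_; map; concatMap; length; filterᵇ; applyUpTo; upTo; allFin; tabulate)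
open import Data.List.Properties using (filter-++; filter-≐; length-++; map-++; map-cong; map-∘)
open import Data.Nat using (ℕ; zero; suc; _+_; _*_; _∸_; _≤_; _<_; _≤ᵇ_; _<ᵇ_; z≤n; s≤s)
open import Data.Nat.Properties
open import Data.Nat.Combinatorics using (_C_; nCk+nC[k+1]≡[n+1]C[k+1]; nCn≡1; k>n⇒nCk≡0)
open import Data.Nat.ListAction using (sum)
open import Data.Nat.ListAction.Properties using (sum-++)
open import Data.Nat.Tactic.RingSolver using (solve-∀)
import Data.Integer as ℤ
open ℤ using (ℤ; +_; +≤+)
import Data.Integer.Properties as ℤ
open import Algebra.Properties.Group (AbelianGroup.group ℤ.+-0-abelianGroup) using (∙-cancelʳ)
open import Algebra.Properties.CommutativeSemigroup ℤ.+-commutativeSemigroup using (xy∙z≈xz∙y)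
open import Algebra.Properties.CommutativeSemigroup +-commutativeSemigroup using (interchange)
open import Data.Product using (_,_)
open import Function using (_∘_; _⇔_; mk⇔; Equivalence)
open import Relation.Binary using (tri<; tri≈; tri>)
open import Relation.Binary.PropositionalEquality
open import Relation.Nullary using (yes; no; contradiction)
open import Relation.Nullary.Decidable using (Dec; ⌊_⌋; T?; does-⇔; isYes≗does)

T-⇔⇒≡ : {b c : Bool} → (T b → T c) → (T c → T b) → b ≡ c
T-⇔⇒≡ {false} {false} _ _ = refl
T-⇔⇒≡ {false} {true}  _ g = ⊥-elim (g _)
T-⇔⇒≡ {true}  {false} f _ = ⊥-elim (f _)
T-⇔⇒≡ {true}  {true}  _ _ = refl

⌊⌋-⇔ : {A B : Set} → A ⇔ B → (a? : Dec A) (b? : Dec B) → ⌊ a? ⌋ ≡ ⌊ b? ⌋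
⌊⌋-⇔ A⇔B a? b? = trans (isYes≗does a?) (trans (does-⇔ A⇔B a? b?) (sym (isYes≗does b?)))

if-then-cong : ∀ b {x y : ℕ} → (b ≡ true → x ≡ y) → (if b then x else 0) ≡ (if b then y else 0)
if-then-cong true  x≡y = x≡y refl
if-then-cong false _   = refl

≤ᵇ-suc : ∀ m n → (suc m ≤ᵇ suc n) ≡ (m ≤ᵇ n)
≤ᵇ-suc zero    n = refl
≤ᵇ-suc (suc m) n = refl

≤ᵇ≡true⇒≤ : ∀ {m n} → (m ≤ᵇ n) ≡ true → m ≤ n
≤ᵇ≡true⇒≤ {m} {n} = ≤ᵇ⇒≤ m n ∘ Equivalence.from T-≡

≤⇒≤ᵇ≡true : ∀ {m n} → m ≤ n → (m ≤ᵇ n) ≡ true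
≤⇒≤ᵇ≡true = Equivalence.to T-≡ ∘ ≤⇒≤ᵇ

>⇒≤ᵇ≡false : ∀ {m n} → n < m → (m ≤ᵇ n) ≡ false
>⇒≤ᵇ≡false {m} {n} n<m = ¬-not (<⇒≱ n<m ∘ ≤ᵇ⇒≤ m n ∘ Equivalence.from T-≡)

module _ {A : Set} where

  length-filterᵇ-++ : (P : A → Bool) (xs ys : List A) →
    length (filterᵇ P (xs ++ ys)) ≡ length (filterᵇ P xs) + length (filterᵇ P ys)
  length-filterᵇ-++ P xs ys =
    trans (cong length (filter-++ (T? ∘ P) xs ys)) (length-++ (filterᵇ P xs))

  length-filterᵇ-∧ : (b : Bool) (P : A → Bool) (xs : List A) →
    length (filterᵇ (λ x → b ∧ P x) xs) ≡ (if b then length (filterᵇ P xs) else 0)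
  length-filterᵇ-∧ true  P xs       = refl
  length-filterᵇ-∧ false P []       = refl
  length-filterᵇ-∧ false P (x ∷ xs) = length-filterᵇ-∧ false P xs

  length-filterᵇ-[_] : (P : A → Bool) (x : A) → length (filterᵇ P (x ∷ [])) ≡ (if P x then 1 else 0)
  length-filterᵇ-[ P ] x with P x
  ... | true  = refl
  ... | false = refl

  length-filterᵇ-cong : {P Q : A → Bool} → (∀ x → P x ≡ Q x) → ∀ xs →
    length (filterᵇ P xs) ≡ length (filterᵇ Q xs)
  length-filterᵇ-cong P≗Q xs = cong length
    (filter-≐ (T? ∘ _) (T? ∘ _) ((λ {x} → subst T (P≗Q x)) , (λ {x} → subst T (sym (P≗Q x)))) xs)

module _ {A B : Set} where

  length-filterᵇ-map : (P : B → Bool) (f : A → B) (xs : List A) →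
    length (filterᵇ P (map f xs)) ≡ length (filterᵇ (P ∘ f) xs)
  length-filterᵇ-map P f []       = refl
  length-filterᵇ-map P f (x ∷ xs) with P (f x)
  ... | true  = cong suc (length-filterᵇ-map P f xs)
  ... | false = length-filterᵇ-map P f xs

  length-filterᵇ-concatMap : (P : B → Bool) (f : A → List B) (xs : List A) →
    length (filterᵇ P (concatMap f xs)) ≡ sum (map (λ x → length (filterᵇ P (f x))) xs)
  length-filterᵇ-concatMap P f []       = refl
  length-filterᵇ-concatMap P f (x ∷ xs) =
    trans (length-filterᵇ-++ P (f x) (concatMap f xs))
          (cong (_+_ (length (filterᵇ P (f x)))) (length-filterᵇ-concatMap P f xs))

  sum-map-concatMap : (g : B → ℕ) (f : A → List B) (xs : List A) →
    sum (map g (concatMap f xs)) ≡ sum (map (λ x → sum (map g (f x))) xs)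
  sum-map-concatMap g f []       = refl
  sum-map-concatMap g f (x ∷ xs) = begin
    sum (map g (f x ++ concatMap f xs))              ≡⟨ cong sum (map-++ g (f x) _) ⟩
    sum (map g (f x) ++ map g (concatMap f xs))      ≡⟨ sum-++ (map g (f x)) _ ⟩
    sum (map g (f x)) + sum (map g (concatMap f xs)) ≡⟨ cong (_+_ (sum (map g (f x)))) (sum-map-concatMap g f xs) ⟩
    sum (map g (f x)) + sum (map (λ x → sum (map g (f x))) xs) ∎
    where open ≡-Reasoning

module _ {A : Set} where

  count : (List A → Bool) → List A → ℕ → ℕ
  count P xs n = length (filterᵇ P (words xs n))

  count-suc : (P : List A → Bool) (xs : List A) (n : ℕ) →
    count P xs (suc n) ≡ sum (map (λ x → count (P ∘ (x ∷_)) xs n) xs)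
  count-suc P xs n =
    trans (length-filterᵇ-concatMap P (λ x → map (x ∷_) (words xs n)) xs)
          (cong sum (map-cong (λ x → length-filterᵇ-map P (x ∷_) (words xs n)) xs))

∑< : ℕ → (ℕ → ℕ) → ℕ
∑< zero    f = 0
∑< (suc n) f = f 0 + ∑< n (f ∘ suc)

sum-map-applyUpTo : ∀ (g : ℕ → ℕ) f n → sum (map g (applyUpTo f n)) ≡ ∑< n (g ∘ f)
sum-map-applyUpTo g f zero    = refl
sum-map-applyUpTo g f (suc n) = cong (_+_ (g (f 0))) (sum-map-applyUpTo g (f ∘ suc) n)

sum-map-tabulate : ∀ {A : Set} n (f : Fin n → A) (g : A → ℕ) (h : ℕ → ℕ) →
  (∀ i → g (f i) ≡ h (toℕ i)) → sum (map g (tabulate f)) ≡ ∑< n h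
sum-map-tabulate zero    f g h g∘f≗h = refl
sum-map-tabulate (suc n) f g h g∘f≗h =
  cong₂ _+_ (g∘f≗h Fin.zero) (sum-map-tabulate n (f ∘ Fin.suc) g (h ∘ suc) (g∘f≗h ∘ Fin.suc))

∑<-cong : ∀ n {f g : ℕ → ℕ} → (∀ c → f c ≡ g c) → ∑< n f ≡ ∑< n g
∑<-cong zero    f≗g = refl
∑<-cong (suc n) f≗g = cong₂ _+_ (f≗g 0) (∑<-cong n (f≗g ∘ suc))

∑<-+ : ∀ n f g → ∑< n (λ e → f e + g e) ≡ ∑< n f + ∑< n g
∑<-+ zero    f g = refl
∑<-+ (suc n) f g =
  trans (cong (_+_ (f 0 + g 0)) (∑<-+ n (f ∘ suc) (g ∘ suc))) (interchange (f 0) (g 0) _ _)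

∑<-last : ∀ n f → ∑< (suc n) f ≡ ∑< n f + f n
∑<-last zero    f = +-identityʳ (f 0)
∑<-last (suc n) f = trans (cong (_+_ (f 0)) (∑<-last n (f ∘ suc))) (sym (+-assoc (f 0) _ _))

∑<-suc-+ : ∀ n f g → ∑< (suc n) f + ∑< n g ≡ f 0 + ∑< n (λ e → f (suc e) + g e)
∑<-suc-+ n f g = trans (+-assoc (f 0) _ _) (cong (_+_ (f 0)) (sym (∑<-+ n (f ∘ suc) g)))

∑<-if : ∀ b n f → ∑< n (λ c → if b then f c else 0) ≡ (if b then ∑< n f else 0)
∑<-if true  n       f = refl
∑<-if false zero    f = refl
∑<-if false (suc n) f = ∑<-if false n (f ∘ suc)

∑<-if-<ᵇ : ∀ {w n} v → w ≤ n → ∑< n (λ c → if c <ᵇ w then v else 0) ≡ w * v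
∑<-if-<ᵇ {zero}  {n}     v z≤n = ∑<-if false n (λ _ → v)
∑<-if-<ᵇ {suc w} {suc n} v (s≤s w≤n) = cong (_+_ v) (∑<-if-<ᵇ v w≤n)

+m-+n≡+[m∸n] : ∀ {m n} → n ≤ m → + m ℤ.- + n ≡ + (m ∸ n)
+m-+n≡+[m∸n] {m} {n} n≤m = trans (ℤ.[+m]-[+n]≡m⊖n m n) (ℤ.⊖-≥ n≤m)

0≤ᵇ+m-+n : ∀ m n → (+ 0 ℤ.≤ᵇ + m ℤ.- + n) ≡ (n ≤ᵇ m)
0≤ᵇ+m-+n m n = T-⇔⇒≡
  (≤⇒≤ᵇ ∘ ℤ.drop‿+≤+ ∘ ℤ.0≤i-j⇒j≤i {+ m} {+ n} ∘ ℤ.≤ᵇ⇒≤)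
  (ℤ.≤⇒≤ᵇ {+ 0} ∘ ℤ.i≤j⇒0≤j-i ∘ +≤+ ∘ ≤ᵇ⇒≤ n m)

-a≤ᵇi≡0≤ᵇi+a : ∀ a i → (ℤ.- + a ℤ.≤ᵇ i) ≡ (+ 0 ℤ.≤ᵇ i ℤ.+ + a)
-a≤ᵇi≡0≤ᵇi+a a i = T-⇔⇒≡
  (ℤ.≤⇒≤ᵇ ∘ subst (+ 0 ℤ.≤_) i-[-a]≡i+a ∘ ℤ.i≤j⇒0≤j-i ∘ ℤ.≤ᵇ⇒≤ {ℤ.- + a})
  (ℤ.≤⇒≤ᵇ {ℤ.- + a} ∘ ℤ.0≤i-j⇒j≤i ∘ subst (+ 0 ℤ.≤_) (sym i-[-a]≡i+a) ∘ ℤ.≤ᵇ⇒≤)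
  where
  i-[-a]≡i+a : i ℤ.- ℤ.- + a ≡ i ℤ.+ + a
  i-[-a]≡i+a = cong (ℤ._+_ i) (ℤ.neg-involutive (+ a))

if-0≤ᵇ+m-+n : (f : ℤ → ℕ) (m n : ℕ) →
  (if + 0 ℤ.≤ᵇ + m ℤ.- + n then f (+ m ℤ.- + n) else 0) ≡ (if n ≤ᵇ m then f (+ (m ∸ n)) else 0)
if-0≤ᵇ+m-+n f m n rewrite 0≤ᵇ+m-+n m n with n ≤ᵇ m in n≤ᵇm
... | true  = cong f (+m-+n≡+[m∸n] (≤ᵇ≡true⇒≤ {n} {m} n≤ᵇm))
... | false = refl

isDPath-shift : ∀ k a h t ss → isDPath k a h t ss ≡ isDPath k 0 (h ℤ.+ + a) (t ℤ.+ + a) ss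
isDPath-shift k a h t [] =
  ⌊⌋-⇔ (mk⇔ (cong (ℤ._+ + a)) (∙-cancelʳ (+ a) h t)) (h ℤ.≟ t) (h ℤ.+ + a ℤ.≟ t ℤ.+ + a)
isDPath-shift k a h t (s ∷ ss) rewrite sym (xy∙z≈xz∙y h (dRise k s) (+ a)) =
  cong₂ _∧_ (-a≤ᵇi≡0≤ᵇi+a a (h ℤ.+ dRise k s)) (isDPath-shift k a (h ℤ.+ dRise k s) t ss)

dWalks : (k t : ℕ) → ℕ → ℕ → ℕ
dWalks k t zero    y = if ⌊ y ≟ t ⌋ then 1 else 0
dWalks k t (suc L) y = dWalks k t L (suc y) + (if k ≤ᵇ suc y then dWalks k t L (suc y ∸ k) else 0)

count-isDPath≡dWalks : ∀ k t L y → count (isDPath k 0 (+ y) (+ t)) dAlphabet L ≡ dWalks k t L y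
count-isDPath≡dWalks k t zero y =
  trans (length-filterᵇ-[ isDPath k 0 (+ y) (+ t) ] [])
        (cong (λ b → if b then 1 else 0) (⌊⌋-⇔ (mk⇔ ℤ.+-injective (cong (λ n → + n))) _ (y ≟ t)))
count-isDPath≡dWalks k t (suc L) y = begin
  count (isDPath k 0 (+ y) (+ t)) dAlphabet (suc L)
    ≡⟨ count-suc _ dAlphabet L ⟩
  walks (+ (y + 1)) + (count (λ w → isDPath k 0 (+ y) (+ t) (Dk ∷ w)) dAlphabet L + 0)
    ≡⟨ cong (λ d → walks (+ (y + 1)) + (d + 0)) (length-filterᵇ-∧ _ _ (words dAlphabet L)) ⟩
  walks (+ (y + 1)) + (walks-if (+ y ℤ.+ (+ 1 ℤ.- + k)) + 0)
    ≡⟨ cong₂ (λ u d → walks (+ u) + (walks-if d + 0)) (+-comm y 1) down-height ⟩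
  walks (+ suc y) + (walks-if (+ suc y ℤ.- + k) + 0)
    ≡⟨ cong (_+_ (walks (+ suc y))) (trans (+-identityʳ _) (if-0≤ᵇ+m-+n walks (suc y) k)) ⟩
  walks (+ suc y) + (if k ≤ᵇ suc y then walks (+ (suc y ∸ k)) else 0)
    ≡⟨ cong₂ (λ u d → u + (if k ≤ᵇ suc y then d else 0))
             (count-isDPath≡dWalks k t L (suc y)) (count-isDPath≡dWalks k t L (suc y ∸ k)) ⟩
  dWalks k t (suc L) y ∎
  where
  open ≡-Reasoning
  walks : ℤ → ℕ
  walks h = count (isDPath k 0 h (+ t)) dAlphabet L
  walks-if : ℤ → ℕ
  walks-if h = if + 0 ℤ.≤ᵇ h then walks h else 0
  down-height : + y ℤ.+ (+ 1 ℤ.- + k) ≡ + suc y ℤ.- + k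
  down-height = trans (sym (ℤ.+-assoc (+ y) (+ 1) (ℤ.- + k))) (cong (λ u → + u ℤ.- + k) (+-comm y 1))

D≡dWalks : ∀ k a n m → D k a n m ≡ dWalks k (k * m + a) (k * n) a
D≡dWalks k a n m =
  trans (length-filterᵇ-cong (isDPath-shift k a (+ 0) (+ (k * m))) (words dAlphabet (k * n)))
        (count-isDPath≡dWalks k (k * m + a) (k * n) a)

colours : ∀ {ℓ} (α β : Fin ℓ → ℕ) → Fin ℓ → ℕ → ℕ
colours α β i H = if ⌊ H ∸ toℕ i ≟ 0 ⌋ then α i else β i

module _ (ℓ : ℕ) (α β : Fin ℓ → ℕ) (t : ℕ) where

  mWalks : ℕ → ℕ → ℕ
  mWalks zero    H = if ⌊ H ≟ t ⌋ then 1 else 0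
  mWalks (suc n) H = mWalks n (suc H)
    + ((if ℓ ≤ᵇ H then mWalks n (H ∸ ℓ) else 0)
       + sum (map (λ i → if toℕ i ≤ᵇ H then colours α β i H * mWalks n (H ∸ toℕ i) else 0) (allFin ℓ)))

  colourOK-+ : ∀ d i c → colourOK ℓ α β (+ d) (MDc i c) ≡ (c <ᵇ (if ⌊ d ≟ 0 ⌋ then α i else β i))
  colourOK-+ d i c rewrite ⌊⌋-⇔ (mk⇔ ℤ.+-injective (cong (λ n → + n))) ((+ d) ℤ.≟ + 0) (d ≟ 0)
    with ⌊ d ≟ 0 ⌋
  ... | true  = refl
  ... | false = refl

  colours≤α+β : ∀ i H → colours α β i H ≤ α i + β i
  colours≤α+β i H with ⌊ H ∸ toℕ i ≟ 0 ⌋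
  ... | true  = m≤m+n (α i) (β i)
  ... | false = m≤n+m (β i) (α i)

  count-isMPath≡mWalks : ∀ n H → count (isMPath ℓ α β (+ H) (+ t)) (mAlphabet ℓ α β) n ≡ mWalks n H
  count-isMPath≡mWalks zero H =
    trans (length-filterᵇ-[ isMPath ℓ α β (+ H) (+ t) ] [])
          (cong (λ b → if b then 1 else 0) (⌊⌋-⇔ (mk⇔ ℤ.+-injective (cong (λ n → + n))) _ (H ≟ t)))
  count-isMPath≡mWalks (suc n) H =
    trans (count-suc (isMPath ℓ α β (+ H) (+ t)) A n) (cong₂ _+_ up (cong₂ _+_ flat diagonal))
    where
    open ≡-Reasoning
    A = mAlphabet ℓ α β
    walks : ℤ → ℕ
    walks h = count (isMPath ℓ α β h (+ t)) A n
    step : MStep ℓ → ℕ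
    step s = count (λ w → isMPath ℓ α β (+ H) (+ t) (s ∷ w)) A n

    up : step MU ≡ mWalks n (suc H)
    up = trans (cong (λ u → walks (+ u)) (+-comm H 1)) (count-isMPath≡mWalks n (suc H))

    flat : step MDl ≡ (if ℓ ≤ᵇ H then mWalks n (H ∸ ℓ) else 0)
    flat = begin
      step MDl
        ≡⟨ length-filterᵇ-∧ _ _ (words A n) ⟩
      (if + 0 ℤ.≤ᵇ + H ℤ.- + ℓ then walks (+ H ℤ.- + ℓ) else 0)
        ≡⟨ if-0≤ᵇ+m-+n walks H ℓ ⟩
      (if ℓ ≤ᵇ H then walks (+ (H ∸ ℓ)) else 0)
        ≡⟨ cong (λ w → if ℓ ≤ᵇ H then w else 0) (count-isMPath≡mWalks n (H ∸ ℓ)) ⟩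
      (if ℓ ≤ᵇ H then mWalks n (H ∸ ℓ) else 0) ∎

    coloured : ∀ i c → step (MDc i c)
      ≡ (if toℕ i ≤ᵇ H then (if c <ᵇ colours α β i H then mWalks n (H ∸ toℕ i) else 0) else 0)
    coloured i c = begin
      step (MDc i c)
        ≡⟨ trans (length-filterᵇ-∧ _ _ (words A n))
                 (cong (λ w → if + 0 ℤ.≤ᵇ + H ℤ.- + toℕ i then w else 0) (length-filterᵇ-∧ _ _ (words A n))) ⟩
      (if + 0 ℤ.≤ᵇ + H ℤ.- + toℕ i then admissible (+ H ℤ.- + toℕ i) else 0)
        ≡⟨ if-0≤ᵇ+m-+n admissible H (toℕ i) ⟩
      (if toℕ i ≤ᵇ H then admissible (+ (H ∸ toℕ i)) else 0)
        ≡⟨ cong (λ w → if toℕ i ≤ᵇ H then w else 0)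
                (cong₂ (λ b w → if b then w else 0) (colourOK-+ (H ∸ toℕ i) i c) (count-isMPath≡mWalks n (H ∸ toℕ i))) ⟩
      (if toℕ i ≤ᵇ H then (if c <ᵇ colours α β i H then mWalks n (H ∸ toℕ i) else 0) else 0) ∎
      where
      admissible : ℤ → ℕ
      admissible h = if colourOK ℓ α β h (MDc i c) then walks h else 0

    colourClass : ∀ i → sum (map step (map (MDc i) (upTo (α i + β i))))
      ≡ (if toℕ i ≤ᵇ H then colours α β i H * mWalks n (H ∸ toℕ i) else 0)
    colourClass i = begin
      sum (map step (map (MDc i) (upTo (α i + β i))))
        ≡⟨ cong sum (sym (map-∘ (upTo (α i + β i)))) ⟩
      sum (map (step ∘ MDc i) (upTo (α i + β i)))
        ≡⟨ sum-map-applyUpTo (step ∘ MDc i) (λ c → c) (α i + β i) ⟩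
      ∑< (α i + β i) (step ∘ MDc i)
        ≡⟨ ∑<-cong (α i + β i) (coloured i) ⟩
      ∑< (α i + β i) (λ c → if toℕ i ≤ᵇ H then (if c <ᵇ colours α β i H then mWalks n (H ∸ toℕ i) else 0) else 0)
        ≡⟨ ∑<-if (toℕ i ≤ᵇ H) (α i + β i) _ ⟩
      (if toℕ i ≤ᵇ H then ∑< (α i + β i) (λ c → if c <ᵇ colours α β i H then mWalks n (H ∸ toℕ i) else 0) else 0)
        ≡⟨ cong (λ w → if toℕ i ≤ᵇ H then w else 0) (∑<-if-<ᵇ (mWalks n (H ∸ toℕ i)) (colours≤α+β i H)) ⟩
      (if toℕ i ≤ᵇ H then colours α β i H * mWalks n (H ∸ toℕ i) else 0) ∎

    diagonal : sum (map step (concatMap (λ i → map (MDc i) (upTo (α i + β i))) (allFin ℓ)))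
      ≡ sum (map (λ i → if toℕ i ≤ᵇ H then colours α β i H * mWalks n (H ∸ toℕ i) else 0) (allFin ℓ))
    diagonal = trans (sum-map-concatMap step _ (allFin ℓ)) (cong sum (map-cong colourClass (allFin ℓ)))

-- A word of r ≤ k steps ending at height E is lowest right after its last down-step, so it
-- goes below 0 exactly when all its e down-steps lie among the first r ∸ suc E steps.
defects : ℕ → ℕ → ℕ → ℕ
defects r e E = if suc E ≤ᵇ r then (r ∸ suc E) C e else 0

r≤E⇒defects≡0 : ∀ {r E} e → r ≤ E → defects r e E ≡ 0
r≤E⇒defects≡0 e r≤E rewrite >⇒≤ᵇ≡false (s≤s r≤E) = refl

defects-pascal : ∀ r e E → defects (suc r) (suc e) E ≡ defects r e E + defects r (suc e) E
defects-pascal r e E with <-cmp E r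
... | tri< E<r _ _ rewrite ≤⇒≤ᵇ≡true E<r | ≤⇒≤ᵇ≡true (m<n⇒m<1+n E<r) | +-∸-assoc 1 E<r =
  sym (nCk+nC[k+1]≡[n+1]C[k+1] (r ∸ suc E) e)
... | tri≈ _ refl _ rewrite >⇒≤ᵇ≡false (≤-refl {suc E}) | ≤⇒≤ᵇ≡true (≤-refl {suc E}) | n∸n≡0 E = refl
... | tri> _ _ r<E rewrite >⇒≤ᵇ≡false (m<n⇒m<1+n r<E) | >⇒≤ᵇ≡false (s≤s r<E) = refl

module _ (k : ℕ) where

  segments : ℕ → ℕ → ℕ → ℕ
  segments zero    zero    y = 1
  segments zero    (suc e) y = 0
  segments (suc r) zero    y = segments r zero (suc y)
  segments (suc r) (suc e) y =
    segments r (suc e) (suc y) + (if k ≤ᵇ suc y then segments r e (suc y ∸ k) else 0)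

  segments-no-downs : ∀ r y → segments r 0 y ≡ 1
  segments-no-downs zero    y = refl
  segments-no-downs (suc r) y = segments-no-downs r (suc y)

  r<e⇒segments≡0 : ∀ {r e} y → r < e → segments r e y ≡ 0
  r<e⇒segments≡0 {zero}  {suc e} y _ = refl
  r<e⇒segments≡0 {suc r} {suc e} y (s≤s r<e) with k ≤ᵇ suc y
  ... | true  = cong₂ _+_ (r<e⇒segments≡0 (suc y) (m<n⇒m<1+n r<e)) (r<e⇒segments≡0 (suc y ∸ k) r<e)
  ... | false = trans (+-identityʳ _) (r<e⇒segments≡0 (suc y) (m<n⇒m<1+n r<e))

  y+r<k*e⇒segments≡0 : ∀ r e y → y + r < k * e → segments r e y ≡ 0
  y+r<k*e⇒segments≡0 r       zero    y lt = contradiction (subst (y + r <_) (*-zeroʳ k) lt) λ ()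
  y+r<k*e⇒segments≡0 zero    (suc e) y lt = refl
  y+r<k*e⇒segments≡0 (suc r) (suc e) y lt =
    cong₂ _+_ (y+r<k*e⇒segments≡0 r (suc e) (suc y) 1+y+r<k*[1+e]) down
    where
    1+y+r<k*[1+e] : suc y + r < k * suc e
    1+y+r<k*[1+e] = subst (_< k * suc e) (+-suc y r) lt
    down : (if k ≤ᵇ suc y then segments r e (suc y ∸ k) else 0) ≡ 0
    down with k ≤? suc y
    ... | no  k≰1+y rewrite >⇒≤ᵇ≡false (≰⇒> k≰1+y) = refl
    ... | yes k≤1+y rewrite ≤⇒≤ᵇ≡true k≤1+y =
      y+r<k*e⇒segments≡0 r e (suc y ∸ k) (+-cancelˡ-< k _ _ (subst₂ _<_
        (trans (cong (_+ r) (sym (m+[n∸m]≡n k≤1+y))) (+-assoc k (suc y ∸ k) r)) (*-suc k e) 1+y+r<k*[1+e]))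

  dWalks-+ : ∀ t L r y →
    dWalks k t (L + r) y ≡ ∑< (suc r) (λ e → segments r e y * dWalks k t L (y + r ∸ k * e))
  dWalks-+ t L zero y rewrite +-identityʳ L | +-identityʳ y | *-zeroʳ k =
    sym (trans (+-identityʳ _) (+-identityʳ _))
  dWalks-+ t L (suc r) y = begin
    dWalks k t (L + suc r) y
      ≡⟨ cong (λ L′ → dWalks k t L′ y) (+-suc L r) ⟩
    dWalks k t (L + r) (suc y) + (if k ≤ᵇ suc y then dWalks k t (L + r) (suc y ∸ k) else 0)
      ≡⟨ cong₂ _+_ (trans (dWalks-+ t L r (suc y)) up) down ⟩
    ∑< (suc (suc r)) firstUp + ∑< (suc r) firstDown
      ≡⟨ ∑<-suc-+ (suc r) firstUp firstDown ⟩
    firstUp 0 + ∑< (suc r) (λ e → firstUp (suc e) + firstDown e)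
      ≡⟨ cong (_+_ (firstUp 0)) (∑<-cong (suc r) (λ e → sym (*-distribʳ-+ (X (suc e)) (segments r (suc e) (suc y)) (downs e)))) ⟩
    ∑< (suc (suc r)) (λ e → segments (suc r) e y * X e) ∎
    where
    open ≡-Reasoning
    X : ℕ → ℕ
    X e = dWalks k t L (y + suc r ∸ k * e)
    firstUp : ℕ → ℕ
    firstUp e = segments r e (suc y) * X e
    downs : ℕ → ℕ
    downs e = if k ≤ᵇ suc y then segments r e (suc y ∸ k) else 0
    firstDown : ℕ → ℕ
    firstDown e = downs e * X (suc e)

    up : ∑< (suc r) (λ e → segments r e (suc y) * dWalks k t L (suc y + r ∸ k * e)) ≡ ∑< (suc (suc r)) firstUp
    up = begin
      ∑< (suc r) (λ e → segments r e (suc y) * dWalks k t L (suc y + r ∸ k * e))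
        ≡⟨ ∑<-cong (suc r) (λ e → cong (λ z → segments r e (suc y) * dWalks k t L (z ∸ k * e)) (sym (+-suc y r))) ⟩
      ∑< (suc r) firstUp
        ≡⟨ sym (+-identityʳ _) ⟩
      ∑< (suc r) firstUp + 0
        ≡⟨ cong (_+_ _) (cong (_* X (suc r)) (sym (r<e⇒segments≡0 (suc y) (n<1+n r)))) ⟩
      ∑< (suc r) firstUp + firstUp (suc r)
        ≡⟨ sym (∑<-last (suc r) firstUp) ⟩
      ∑< (suc (suc r)) firstUp ∎

    down : (if k ≤ᵇ suc y then dWalks k t (L + r) (suc y ∸ k) else 0) ≡ ∑< (suc r) firstDown
    down with k ≤? suc y
    ... | no  k≰1+y rewrite >⇒≤ᵇ≡false (≰⇒> k≰1+y) = sym (∑<-if false (suc r) (λ _ → 0))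
    ... | yes k≤1+y rewrite ≤⇒≤ᵇ≡true k≤1+y = trans (dWalks-+ t L r (suc y ∸ k))
      (∑<-cong (suc r) (λ e → cong (λ z → segments r e (suc y ∸ k) * dWalks k t L z) (index e)))
      where
      index : ∀ e → suc y ∸ k + r ∸ k * e ≡ y + suc r ∸ k * suc e
      index e = begin
        suc y ∸ k + r ∸ k * e           ≡⟨ sym ([m+n]∸[m+o]≡n∸o k (suc y ∸ k + r) (k * e)) ⟩
        k + (suc y ∸ k + r) ∸ (k + k * e) ≡⟨ cong₂ _∸_ (trans (sym (+-assoc k _ r)) (cong (_+ r) (m+[n∸m]≡n k≤1+y))) (sym (*-suc k e)) ⟩
        suc y + r ∸ k * suc e            ≡⟨ cong (_∸ k * suc e) (sym (+-suc y r)) ⟩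
        y + suc r ∸ k * suc e ∎

  1+y<k⇒defects≡C : ∀ r e y E → r < k → suc y < k → y + suc r ≡ k * suc e + E → defects r e E ≡ r C e
  1+y<k⇒defects≡C r zero y E r<k 1+y<k eq =
    cong (λ b → if b then 1 else 0) (≤⇒≤ᵇ≡true (+-cancelˡ-< k E r (begin-strict
      k + E     ≡⟨ cong (_+ E) (sym (*-identityʳ k)) ⟩
      k * 1 + E ≡⟨ sym eq ⟩
      y + suc r ≡⟨ +-suc y r ⟩
      suc y + r <⟨ +-monoˡ-< r 1+y<k ⟩
      k + r     ∎)))
    where open ≤-Reasoning
  1+y<k⇒defects≡C r (suc e) y E r<k 1+y<k eq = contradiction (+-mono-<-≤ 1+y<k (<⇒≤ r<k)) (≤⇒≯ (begin
    k + k               ≤⟨ +-monoʳ-≤ k (m≤m+n k (k * e)) ⟩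
    k + (k + k * e)     ≡⟨ cong (_+_ k) (sym (*-suc k e)) ⟩
    k + k * suc e       ≡⟨ sym (*-suc k (suc e)) ⟩
    k * suc (suc e)     ≤⟨ m≤m+n _ E ⟩
    k * suc (suc e) + E ≡⟨ sym eq ⟩
    y + suc r           ≡⟨ +-suc y r ⟩
    suc y + r           ∎))
    where open ≤-Reasoning

  segments+defects≡C : ∀ r e y E → r ≤ k → y + r ≡ k * e + E → segments r e y + defects r e E ≡ r C e
  segments+defects≡C r zero y E _ eq rewrite segments-no-downs r y
    | r≤E⇒defects≡0 0 (subst (r ≤_) (trans eq (cong (_+ E) (*-zeroʳ k))) (m≤n+m r y)) = refl
  segments+defects≡C zero    (suc e) y E _ _ = refl
  segments+defects≡C (suc r) (suc e) y E 1+r≤k eq = begin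
    segments r (suc e) (suc y) + down + defects (suc r) (suc e) E
      ≡⟨ cong (_+_ _) (trans (defects-pascal r e E) (+-comm (defects r e E) _)) ⟩
    segments r (suc e) (suc y) + down + (defects r (suc e) E + defects r e E)
      ≡⟨ interchange (segments r (suc e) (suc y)) down _ _ ⟩
    (segments r (suc e) (suc y) + defects r (suc e) E) + (down + defects r e E)
      ≡⟨ cong₂ _+_ (segments+defects≡C r (suc e) (suc y) E (<⇒≤ 1+r≤k) 1+y+r≡k*[1+e]+E) down+defects≡C ⟩
    r C suc e + r C e
      ≡⟨ +-comm (r C suc e) (r C e) ⟩
    r C e + r C suc e
      ≡⟨ nCk+nC[k+1]≡[n+1]C[k+1] r e ⟩
    suc r C suc e ∎
    where
    open ≡-Reasoning
    down : ℕ
    down = if k ≤ᵇ suc y then segments r e (suc y ∸ k) else 0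
    1+y+r≡k*[1+e]+E : suc y + r ≡ k * suc e + E
    1+y+r≡k*[1+e]+E = trans (sym (+-suc y r)) eq

    down+defects≡C : down + defects r e E ≡ r C e
    down+defects≡C with k ≤? suc y
    ... | yes k≤1+y rewrite ≤⇒≤ᵇ≡true k≤1+y =
      segments+defects≡C r e (suc y ∸ k) E (<⇒≤ 1+r≤k) (+-cancelˡ-≡ k _ _ (begin
        k + (suc y ∸ k + r) ≡⟨ trans (sym (+-assoc k _ r)) (cong (_+ r) (m+[n∸m]≡n k≤1+y)) ⟩
        suc y + r           ≡⟨ 1+y+r≡k*[1+e]+E ⟩
        k * suc e + E       ≡⟨ trans (cong (_+ E) (*-suc k e)) (+-assoc k _ E) ⟩
        k + (k * e + E)     ∎))
    ... | no k≰1+y rewrite >⇒≤ᵇ≡false (≰⇒> k≰1+y) = 1+y<k⇒defects≡C r e y E 1+r≤k (≰⇒> k≰1+y) eq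

module _ (ℓ a : ℕ) (a≤ℓ : a ≤ ℓ) (m : ℕ) where

  private
    k : ℕ
    k = suc ℓ

    α β : Fin ℓ → ℕ
    α i = k C suc (toℕ i) ∸ (k ∸ a ∸ 1) C suc (toℕ i)
    β i = k C suc (toℕ i)

  block-height : ∀ {H e} → e ≤ suc H → k * H + a + k ≡ k * e + (k * (suc H ∸ e) + a)
  block-height {H} {e} e≤1+H = begin
    k * H + a + k             ≡⟨ shuffle k H a ⟩
    k * suc H + a             ≡⟨ cong (λ h → k * h + a) (sym (m+[n∸m]≡n e≤1+H)) ⟩
    k * (e + (suc H ∸ e)) + a ≡⟨ distribute k e (suc H ∸ e) a ⟩
    k * e + (k * (suc H ∸ e) + a) ∎
    where
    open ≡-Reasoning
    shuffle : ∀ k H a → k * H + a + k ≡ k * suc H + a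
    shuffle = solve-∀
    distribute : ∀ k e j a → k * (e + j) + a ≡ k * e + (k * j + a)
    distribute = solve-∀

  block-segments : ∀ {H e} → e ≤ suc H →
    segments k k e (k * H + a) ≡ k C e ∸ defects k e (k * (suc H ∸ e) + a)
  block-segments {H} {e} e≤1+H = sym (trans
    (cong (_∸ defects k e E) (sym (segments+defects≡C k k e (k * H + a) E ≤-refl (block-height e≤1+H))))
    (m+n∸n≡m _ (defects k e E)))
    where
    E = k * (suc H ∸ e) + a

  block-segments-top : ∀ {H} → ℓ ≤ H → segments k k k (k * H + a) ≡ 1
  block-segments-top {H} ℓ≤H = begin
    segments k k k (k * H + a)               ≡⟨ block-segments (s≤s ℓ≤H) ⟩
    k C k ∸ defects k k (k * (H ∸ ℓ) + a)    ≡⟨ cong₂ _∸_ (nCn≡1 k) (defects-diagonal (k * (H ∸ ℓ) + a)) ⟩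
    1 ∎
    where
    open ≡-Reasoning
    defects-diagonal : ∀ E → defects k k E ≡ 0
    defects-diagonal E with suc E ≤ᵇ k
    ... | true  = k>n⇒nCk≡0 (s≤s (m∸n≤m ℓ E))
    ... | false = refl

  block-segments-colour : ∀ {H} i → toℕ i ≤ H → segments k k (suc (toℕ i)) (k * H + a) ≡ colours α β i H
  block-segments-colour {H} i i≤H rewrite block-segments (s≤s i≤H) with H ∸ toℕ i
  ... | zero  rewrite *-zeroʳ k | ≤⇒≤ᵇ≡true (s≤s a≤ℓ) | ∸-+-assoc k a 1 | +-comm a 1 = refl
  ... | suc d rewrite r≤E⇒defects≡0 (suc (toℕ i)) (≤-trans (m≤m*n k (suc d)) (m≤m+n _ a)) = refl

  block-term : ∀ n → (∀ H → dWalks k (k * m + a) (k * n) (k * H + a) ≡ mWalks ℓ α β m n H) → ∀ H e →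
    segments k k e (k * H + a) * dWalks k (k * m + a) (k * n) (k * H + a + k ∸ k * e)
      ≡ (if e ≤ᵇ suc H then segments k k e (k * H + a) * mWalks ℓ α β m n (suc H ∸ e) else 0)
  block-term n IH H e with e ≤? suc H
  ... | yes e≤1+H rewrite ≤⇒≤ᵇ≡true e≤1+H =
    cong (_*_ (segments k k e (k * H + a))) (begin
      dWalks k (k * m + a) (k * n) (k * H + a + k ∸ k * e)
        ≡⟨ cong (λ z → dWalks k (k * m + a) (k * n) (z ∸ k * e)) (block-height e≤1+H) ⟩
      dWalks k (k * m + a) (k * n) (k * e + (k * (suc H ∸ e) + a) ∸ k * e)
        ≡⟨ cong (dWalks k (k * m + a) (k * n)) (m+n∸m≡n (k * e) _) ⟩
      dWalks k (k * m + a) (k * n) (k * (suc H ∸ e) + a)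
        ≡⟨ IH (suc H ∸ e) ⟩
      mWalks ℓ α β m n (suc H ∸ e) ∎)
    where open ≡-Reasoning
  ... | no e≰1+H rewrite >⇒≤ᵇ≡false (≰⇒> e≰1+H) =
    cong (_* dWalks k (k * m + a) (k * n) (k * H + a + k ∸ k * e)) (y+r<k*e⇒segments≡0 k k e (k * H + a) (begin-strict
      k * H + a + k     <⟨ +-monoˡ-< k (+-monoʳ-< (k * H) (s≤s a≤ℓ)) ⟩
      k * H + k + k     ≡⟨ twice-more k H ⟩
      k * suc (suc H)   ≤⟨ *-monoʳ-≤ k (≰⇒> e≰1+H) ⟩
      k * e             ∎))
    where
    open ≤-Reasoning
    twice-more : ∀ k H → k * H + k + k ≡ k * suc (suc H)
    twice-more = solve-∀

  blocks≡mWalks : ∀ n H →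
    ∑< (suc k) (λ e → if e ≤ᵇ suc H then segments k k e (k * H + a) * mWalks ℓ α β m n (suc H ∸ e) else 0)
      ≡ mWalks ℓ α β m (suc n) H
  blocks≡mWalks n H = begin
    f 0 + ∑< k (f ∘ suc)            ≡⟨ cong (_+_ (f 0)) (∑<-last ℓ (f ∘ suc)) ⟩
    f 0 + (∑< ℓ (f ∘ suc) + f k)    ≡⟨ cong (_+_ (f 0)) (+-comm (∑< ℓ (f ∘ suc)) (f k)) ⟩
    f 0 + (f k + ∑< ℓ (f ∘ suc))    ≡⟨ cong₂ _+_ up (cong₂ _+_ top (sym coloured)) ⟩
    mWalks ℓ α β m (suc n) H        ∎
    where
    open ≡-Reasoning
    f : ℕ → ℕ
    f e = if e ≤ᵇ suc H then segments k k e (k * H + a) * mWalks ℓ α β m n (suc H ∸ e) else 0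
    up : f 0 ≡ mWalks ℓ α β m n (suc H)
    up = trans (cong (_* mWalks ℓ α β m n (suc H)) (segments-no-downs k k (k * H + a))) (+-identityʳ _)
    top : f k ≡ (if ℓ ≤ᵇ H then mWalks ℓ α β m n (H ∸ ℓ) else 0)
    top = trans
      (cong (λ b → if b then segments k k k (k * H + a) * mWalks ℓ α β m n (H ∸ ℓ) else 0) (≤ᵇ-suc ℓ H))
      (if-then-cong (ℓ ≤ᵇ H) λ ℓ≤ᵇH →
        trans (cong (_* mWalks ℓ α β m n (H ∸ ℓ)) (block-segments-top (≤ᵇ≡true⇒≤ ℓ≤ᵇH))) (+-identityʳ _))
    coloured : sum (map (λ i → if toℕ i ≤ᵇ H then colours α β i H * mWalks ℓ α β m n (H ∸ toℕ i) else 0) (allFin ℓ))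
      ≡ ∑< ℓ (f ∘ suc)
    coloured = sum-map-tabulate ℓ (λ i → i) _ (f ∘ suc) λ i →
      trans (if-then-cong (toℕ i ≤ᵇ H) λ i≤ᵇH →
               cong (_* mWalks ℓ α β m n (H ∸ toℕ i)) (sym (block-segments-colour i (≤ᵇ≡true⇒≤ i≤ᵇH))))
            (cong (λ b → if b then segments k k (suc (toℕ i)) (k * H + a) * mWalks ℓ α β m n (H ∸ toℕ i) else 0)
                  (sym (≤ᵇ-suc (toℕ i) H)))

  dWalks≡mWalks : ∀ n H → dWalks k (k * m + a) (k * n) (k * H + a) ≡ mWalks ℓ α β m n H
  dWalks≡mWalks zero H rewrite *-zeroʳ k = cong (λ b → if b then 1 else 0)
    (⌊⌋-⇔ (mk⇔ (*-cancelˡ-≡ H m k ∘ +-cancelʳ-≡ a _ _) (cong (λ h → k * h + a))) _ (H ≟ m))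
  dWalks≡mWalks (suc n) H = begin
    dWalks k (k * m + a) (k * suc n) y
      ≡⟨ cong (λ L → dWalks k (k * m + a) L y) (trans (*-suc k n) (+-comm k (k * n))) ⟩
    dWalks k (k * m + a) (k * n + k) y
      ≡⟨ dWalks-+ k (k * m + a) (k * n) k y ⟩
    ∑< (suc k) (λ e → segments k k e y * dWalks k (k * m + a) (k * n) (y + k ∸ k * e))
      ≡⟨ ∑<-cong (suc k) (block-term n (dWalks≡mWalks n) H) ⟩
    ∑< (suc k) (λ e → if e ≤ᵇ suc H then segments k k e y * mWalks ℓ α β m n (suc H ∸ e) else 0)
      ≡⟨ blocks≡mWalks n H ⟩
    mWalks ℓ α β m (suc n) H ∎
    where
    open ≡-Reasoning
    y = k * H + a

corollary3p2 : (k : ℕ) → 2 ≤ k → (n m a : ℕ) → m ≤ n → a ≤ k ∸ 1 →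
    D k a n m
      ≡ M (k ∸ 1)
          (λ (i : Fin (k ∸ 1)) → k C suc (toℕ i) ∸ (k ∸ a ∸ 1) C suc (toℕ i))
          (λ (i : Fin (k ∸ 1)) → k C suc (toℕ i))
          n m
corollary3p2 (suc ℓ) _ n m a _ a≤ℓ = begin
  D (suc ℓ) a n m
    ≡⟨ D≡dWalks (suc ℓ) a n m ⟩
  dWalks (suc ℓ) (suc ℓ * m + a) (suc ℓ * n) a
    ≡⟨ cong (λ h → dWalks (suc ℓ) (suc ℓ * m + a) (suc ℓ * n) (h + a)) (sym (*-zeroʳ (suc ℓ))) ⟩
  dWalks (suc ℓ) (suc ℓ * m + a) (suc ℓ * n) (suc ℓ * 0 + a)
    ≡⟨ dWalks≡mWalks ℓ a a≤ℓ m n 0 ⟩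
  mWalks ℓ _ _ m n 0
    ≡⟨ sym (count-isMPath≡mWalks ℓ _ _ m n 0) ⟩
  M ℓ _ _ n m ∎
  where open ≡-Reasoning
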